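{- Let $d\ge 2$ and $0\le k\le d-1$ be integers, and let $G(d,k)$ be as defined in the context. (i) If $k\ge\left\lfloor\frac{d+1}{2}\right\rfloor$, then $G(d,k)=1$. (ii) If $k<\left\lfloor\frac{d+1}{2}\right\rfloor$ and $k$ is even, let $e$ be the integer with $2^{e}\le k+1<2^{e+1}$. Then $G(d,k)=2$ if $d-k+1\equiv 0 \pmod{2^{e+1}}$, and $G(d,k)=1$ otherwise. (iii) If $k<\left\lfloor\frac{d+1}{2}\right\rfloor$ and $k$ is odd, let $p_1,\dots,p_t$ be the primes $\le k+1$, and let $e_i\ge 1$ be the integers with $p_i^{e_i}\le k+1<p_i^{e_i+1}$. Then \[G(d,k)=\frac{d-k+1}{\gcd(d-k+1,\,p_1^{e_1}p_2^{e_2}\cdots p_t^{e_t})}.\]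
   Context: Binomial coefficients satisfy $\binom{a}{b}=0$ when $0\le a<b$. Let $\delta=\lfloor d/2\rfloor$ and define, for $0\le i\le\delta$ and $0\le k\le d-1$, $m_{i,k}=\binom{d+1-i}{k+1}-\binom{i}{k+1}$. Define $G(d,k)=\gcd(m_{1,k},m_{2,k},\dots,m_{\delta,k})$. -}

module Defs where

open import Data.Nat using (ℕ; zero; suc; _+_; _*_; _∸_; _^_; _≤_; _<_; _/_; ≢-nonZero)
open import Data.Nat.Properties using (_≤?_)
open import Data.Nat.GCD using (gcd; gcd[m,n]≢0)
open import Data.Nat.Combinatorics using (_C_)
open import Data.Nat.Primality using (Prime; prime?)
open import Data.Nat.ListAction using (product)
open import Data.List using (List; []; _∷_; map; filter; upTo)
open import Data.Sum using (inj₁)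

-- m_{i,k} = C(d+1-i, k+1) - C(i, k+1)   (used only for 1 ≤ i ≤ ⌊d/2⌋,
-- where d+1-i ≥ i, so C(d+1-i,k+1) ≥ C(i,k+1) and truncated subtraction is exact)
m : ℕ → ℕ → ℕ → ℕ
m d i k = ((d + 1 ∸ i) C (k + 1)) ∸ (i C (k + 1))

gcdList : List ℕ → ℕ
gcdList []       = 0
gcdList (x ∷ xs) = gcd x (gcdList xs)

oneTo : ℕ → List ℕ
oneTo n = map suc (upTo n)

G : ℕ → ℕ → ℕ
G d k = gcdList (map (λ i → m d i k) (oneTo (d / 2)))

primesUpTo : ℕ → List ℕ
primesUpTo n = filter prime? (oneTo n)

_/gcd_ : ℕ → ℕ → ℕ
_/gcd_ n q = ((suc n) / gcd (suc n) q) {{≢-nonZero (gcd[m,n]≢0 (suc n) q (inj₁ (λ ())))}}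

-- With n = d + 1 and K = k + 1 consider the integer table
--   h j i = (-1)^j C(n - j - i, K - j) - C(i, K - j).
-- Pascal's rule gives h j (i + 1) = h j i + h (j + 1) i, and row K is constant. Row 0 is
-- m_{i,k}, extended to 0 < i < n by h 0 (n - i) = - h 0 i; column 0 consists of
-- ±C(M + c, c + 1) for c < K, where M = d - k + 1, and of (-1)^K - 1. When K < d the
-- recurrence carries divisibility both ways between row 0 and column 0, so G is the gcd of
-- the C(M + c, c + 1) and (-1)^K - 1. The absorption identity (c + 1) C(M + c, c + 1) =
-- M C(M + c, c) makes M / gcd(M, lcm(1..K)) divide every C(M + c, c + 1); conversely a common
-- divisor g satisfies g p^a ∣ M for each prime power p^a ≤ K dividing M, since C(M + i, i)
-- is prime to p for i < p^a. As the product of the p^{e_i} is lcm(1..K), this gives (iii);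
-- for K odd the extra entry -2 gives (ii), and M ≤ K gives (i) (when K = d, m_{1,k} = 1).
module Submission where

open import Defs
open import Data.Nat using (ℕ; suc; _+_; _*_; _∸_; _^_; _≤_; _<_; _/_; _%_)
open import Data.Nat.Divisibility using (_∣_)
open import Data.Nat.Primality using (Prime)
open import Data.Nat.ListAction using (product)
open import Data.List using (map)
open import Data.Product using (_×_)
open import Relation.Binary.PropositionalEquality using (_≡_; _≢_)
open import Relation.Nullary using (¬_)

open import Data.Nat.Base using (zero; z≤n; s≤s; z<s; s<s; NonZero; ≢-nonZero; ≢-nonZero⁻¹; >-nonZero; nonTrivial⇒n>1; _≤′_; ≤′-refl; ≤′-step)
open import Data.Nat.Properties
open import Data.Nat.Divisibility
open import Data.Nat.DivMod using (m≡m%n+[m/n]*n; m%n<n; m/n*n≤m; m≥n⇒m/n>0)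
open import Data.Nat.GCD using (gcd; gcd-greatest; gcd[m,n]∣m; gcd[m,n]∣n; gcd[m,n]≢0; c*gcd[m,n]≡gcd[cm,cn])
open import Data.Nat.Coprimality using (Coprime; coprime-divisor; coprime⇒gcd≡1)
open import Data.Nat.Primality using (prime?; prime[2]; prime⇒nonZero; prime⇒nonTrivial; prime⇒irreducible; euclidsLemma)
open import Data.Nat.Primality.Factorisation using (factorise)
open import Data.Nat.Combinatorics using (_C_; nC1≡n; nCn≡1; nCk+nC[k+1]≡[n+1]C[k+1])
open import Data.Nat.Combinatorics.Specification using (k>n⇒nCk≡0)
open import Data.Nat.Induction using (<-rec)
open import Data.Nat.ListAction.Properties using (product-++)
open import Data.Nat.Solver using (module +-*-Solver)
open import Data.Integer as ℤ using (ℤ; +_; -_; _-_; _⊖_)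
open import Data.Integer.Properties as ℤ using (pos-+; neg-distrib-+; neg-involutive; ⊖-≥; ⊖-swap; [+m]-[+n]≡m⊖n; i≡j⇒i-j≡0)
open import Data.Integer.Divisibility.Signed as ℤ using () renaming (_∣_ to _∣ᶻ_)
import Data.Integer.Solver as ℤ-Solver
open import Data.List using ([]; _∷_; [_]; _++_; filter; upTo)
open import Data.List.Properties using (map-++; filter-++; upTo-∷ʳ)
open import Data.List.Membership.Propositional using (_∈_)
open import Data.List.Membership.Propositional.Properties using (∈-map⁺; ∈-upTo⁺)
open import Data.List.Relation.Unary.All as All using (All; _∷_)
import Data.List.Relation.Unary.All.Properties as All
open import Data.List.Relation.Unary.Any using (here; there)
open import Data.Product using (Σ-syntax; _,_; proj₁; proj₂)
open import Data.Sum using (_⊎_; inj₁; inj₂)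
open import Relation.Nullary using (yes; no; contradiction)
open import Relation.Binary.PropositionalEquality using (refl; sym; trans; cong; cong₂; subst; subst₂; module ≡-Reasoning)

∸-suc : ∀ {m n} → n < m → m ∸ n ≡ suc (m ∸ suc n)
∸-suc {suc m} {zero}  _         = refl
∸-suc {suc m} {suc n} (s<s n<m) = ∸-suc n<m

nCk≤[n+1]Ck : ∀ n k → n C k ≤ suc n C k
nCk≤[n+1]Ck n zero    = ≤-refl
nCk≤[n+1]Ck n (suc k) = subst (n C suc k ≤_) (nCk+nC[k+1]≡[n+1]C[k+1] n k) (m≤n+m _ _)

C-monoˡ-≤ : ∀ k {m n} → m ≤ n → m C k ≤ n C k
C-monoˡ-≤ k m≤n = go (≤⇒≤′ m≤n)
  where
  go : ∀ {m n} → m ≤′ n → m C k ≤ n C k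
  go ≤′-refl         = ≤-refl
  go (≤′-step m≤′n) = ≤-trans (go m≤′n) (nCk≤[n+1]Ck _ k)

[k+1]*[n+1]C[k+1]≡[n+1]*nCk : ∀ n k → suc k * (suc n C suc k) ≡ suc n * (n C k)
[k+1]*[n+1]C[k+1]≡[n+1]*nCk n       zero    = trans (+-identityʳ _) (trans (nC1≡n (suc n)) (sym (*-identityʳ _)))
[k+1]*[n+1]C[k+1]≡[n+1]*nCk zero    (suc k) = *-zeroʳ (suc (suc k))
[k+1]*[n+1]C[k+1]≡[n+1]*nCk (suc n) (suc k) = begin
  suc (suc k) * (suc (suc n) C suc (suc k))
    ≡⟨ cong (suc (suc k) *_) (sym (nCk+nC[k+1]≡[n+1]C[k+1] (suc n) (suc k))) ⟩
  suc (suc k) * (c + e)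
    ≡⟨ regroupˡ (suc k) c e ⟩
  suc k * c + c + suc (suc k) * e
    ≡⟨ cong₂ (λ u v → u + c + v) ([k+1]*[n+1]C[k+1]≡[n+1]*nCk n k) ([k+1]*[n+1]C[k+1]≡[n+1]*nCk n (suc k)) ⟩
  suc n * a + c + suc n * b
    ≡⟨ regroupʳ (suc n) a b c ⟩
  suc n * (a + b) + c
    ≡⟨ cong (λ z → suc n * z + c) (nCk+nC[k+1]≡[n+1]C[k+1] n k) ⟩
  suc n * c + c
    ≡⟨ +-comm (suc n * c) c ⟩
  suc (suc n) * c ∎
  where
  open ≡-Reasoning
  open +-*-Solver
  a b c e : ℕ
  a = n C k
  b = n C suc k
  c = suc n C suc k
  e = suc n C suc (suc k)
  regroupˡ : ∀ x c e → suc x * (c + e) ≡ x * c + c + suc x * e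
  regroupˡ = solve 3 (λ x c e → (con 1 :+ x) :* (c :+ e) := x :* c :+ c :+ (con 1 :+ x) :* e) refl
  regroupʳ : ∀ m a b c → m * a + c + m * b ≡ m * (a + b) + c
  regroupʳ = solve 4 (λ m a b c → m :* a :+ c :+ m :* b := m :* (a :+ b) :+ c) refl

[k+1]*[m+k]C[k+1]≡m*[m+k]Ck : ∀ m k → suc k * ((m + k) C suc k) ≡ m * ((m + k) C k)
[k+1]*[m+k]C[k+1]≡m*[m+k]Ck m k = +-cancelˡ-≡ (suc k * x) _ _ (begin
  suc k * x + suc k * y        ≡⟨ sym (*-distribˡ-+ (suc k) x y) ⟩
  suc k * (x + y)              ≡⟨ cong (suc k *_) (nCk+nC[k+1]≡[n+1]C[k+1] (m + k) k) ⟩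
  suc k * (suc (m + k) C suc k) ≡⟨ [k+1]*[n+1]C[k+1]≡[n+1]*nCk (m + k) k ⟩
  suc (m + k) * x              ≡⟨ cong (_* x) (trans (sym (+-suc m k)) (+-comm m (suc k))) ⟩
  (suc k + m) * x              ≡⟨ *-distribʳ-+ x (suc k) m ⟩
  suc k * x + m * x            ∎)
  where
  open ≡-Reasoning
  x y : ℕ
  x = (m + k) C k
  y = (m + k) C suc k

module DifferenceTable {n K : ℕ} (h : ℕ → ℕ → ℤ)
  (h-step : ∀ j i → j < K → j + i < n → h j (suc i) ≡ h j i ℤ.+ h (suc j) i)
  (h-top : ∀ i → h K i ≡ h K 0) where

  ∣column₀⇒∣ : ∀ {x} → (∀ j → j ≤ K → x ∣ᶻ h j 0) → ∀ i j → j ≤ K → i + j < n → x ∣ᶻ h j i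
  ∣column₀⇒∣ x∣col zero    j j≤K _ = x∣col j j≤K
  ∣column₀⇒∣ x∣col (suc i) j j≤K i+j<n with m≤n⇒m<n∨m≡n j≤K
  ... | inj₂ refl = subst (_ ∣ᶻ_) (sym (h-top (suc i))) (x∣col K j≤K)
  ... | inj₁ j<K  = subst (_ ∣ᶻ_) (sym (h-step j i j<K (subst (_< n) (+-comm i j) i<n′)))
                      (ℤ.∣m∣n⇒∣m+n (∣column₀⇒∣ x∣col i j j≤K i<n′)
                                 (∣column₀⇒∣ x∣col i (suc j) j<K (subst (_< n) (sym (+-suc i j)) i+j<n)))
    where
    i<n′ : i + j < n
    i<n′ = <-trans (n<1+n (i + j)) i+j<n

  ∣column₀⇒∣row₀ : ∀ {x} → (∀ j → j ≤ K → x ∣ᶻ h j 0) → ∀ i → i < n → x ∣ᶻ h 0 i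
  ∣column₀⇒∣row₀ x∣col i i<n = ∣column₀⇒∣ x∣col i 0 z≤n (subst (_< n) (sym (+-identityʳ i)) i<n)

  ∣row₀⇒∣ : ∀ {g} → (∀ i → 0 < i → i < n → g ∣ᶻ h 0 i) → ∀ j → j ≤ K → ∀ i → 0 < i → i + j < n → g ∣ᶻ h j i
  ∣row₀⇒∣ g∣row zero    _     i 0<i i+0<n = g∣row i 0<i (subst (_< n) (+-identityʳ i) i+0<n)
  ∣row₀⇒∣ g∣row (suc j) j<K i 0<i i+j<n =
    ℤ.∣m+n∣m⇒∣n (subst (_ ∣ᶻ_) (h-step j i j<K j+i<n)
                (∣row₀⇒∣ g∣row j (<⇒≤ j<K) (suc i) z<s (subst (_< n) (+-suc i j) i+j<n)))
              (∣row₀⇒∣ g∣row j (<⇒≤ j<K) i 0<i (≤-<-trans (+-monoʳ-≤ i (n≤1+n j)) i+j<n))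
    where
    j+i<n : j + i < n
    j+i<n = subst (_< n) (+-comm i j) (≤-<-trans (+-monoʳ-≤ i (n≤1+n j)) i+j<n)

  ∣column₁⇒∣column₀ : ∀ {g} → K < n → (∀ j → j ≤ K → g ∣ᶻ h j 1) → ∀ j → j ≤ K → g ∣ᶻ h j 0
  ∣column₁⇒∣column₀ {g} K<n g∣col₁ j j≤K = from-top (K ∸ j) j (m+[n∸m]≡n j≤K)
    where
    from-top : ∀ t j → j + t ≡ K → g ∣ᶻ h j 0
    from-top zero    j j+0≡K = subst (λ j → g ∣ᶻ h j 0) (trans (sym j+0≡K) (+-identityʳ j))
                                 (subst (g ∣ᶻ_) (h-top 1) (g∣col₁ K ≤-refl))
    from-top (suc t) j j+t≡K =
      ℤ.∣m+n∣n⇒∣m (subst (g ∣ᶻ_) (h-step j 0 j<K (subst (_< n) (sym (+-identityʳ j)) (<-trans j<K K<n)))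
                   (g∣col₁ j (<⇒≤ j<K)))
                (from-top t (suc j) (trans (sym (+-suc j t)) j+t≡K))
      where
      j<K : j < K
      j<K = subst (j <_) j+t≡K (m<m+n j z<s)

  ∣row₀⇒∣column₀ : ∀ {g} → suc K < n → (∀ i → 0 < i → i < n → g ∣ᶻ h 0 i) → ∀ j → j ≤ K → g ∣ᶻ h j 0
  ∣row₀⇒∣column₀ 1+K<n g∣row = ∣column₁⇒∣column₀ (<-trans (n<1+n _) 1+K<n)
    (λ j j≤K → ∣row₀⇒∣ g∣row j j≤K 1 z<s (≤-<-trans (s≤s j≤K) 1+K<n))

negⁿ : ℕ → ℤ → ℤ
negⁿ zero    z = z
negⁿ (suc j) z = - negⁿ j z

negⁿ-+ : ∀ j x y → negⁿ j (x ℤ.+ y) ≡ negⁿ j x ℤ.+ negⁿ j y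
negⁿ-+ zero    x y = refl
negⁿ-+ (suc j) x y = trans (cong -_ (negⁿ-+ j x y)) (neg-distrib-+ (negⁿ j x) (negⁿ j y))

negⁿ-even : ∀ q z → negⁿ (q * 2) z ≡ z
negⁿ-even zero    z = refl
negⁿ-even (suc q) z = trans (neg-involutive _) (negⁿ-even q z)

∣negⁿ : ∀ {x} j {z} → x ∣ᶻ z → x ∣ᶻ negⁿ j z
∣negⁿ zero    x∣z = x∣z
∣negⁿ (suc j) x∣z = ℤ.∣m⇒∣-m (∣negⁿ j x∣z)

∣negⁿ⁻¹ : ∀ {x} j {z} → x ∣ᶻ negⁿ j z → x ∣ᶻ z
∣negⁿ⁻¹ zero    x∣z = x∣z
∣negⁿ⁻¹ (suc j) x∣z = ∣negⁿ⁻¹ j (subst (_ ∣ᶻ_) (neg-involutive _) (ℤ.∣m⇒∣-m x∣z))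

module BinomialTable (n K : ℕ) where

  h : ℕ → ℕ → ℤ
  h j i = negⁿ j (+ ((n ∸ j ∸ i) C (K ∸ j))) - + (i C (K ∸ j))

  h-step : ∀ j i → j < K → j + i < n → h j (suc i) ≡ h j i ℤ.+ h (suc j) i
  h-step j i j<K j+i<n
    rewrite ∸-suc j<K | ∸-+-assoc n j (suc i) | ∸-+-assoc n j i | +-suc j i | ∸-suc j+i<n | sym (∸-+-assoc n (suc j) i) =
    pascal j (n ∸ suc j ∸ i) (K ∸ suc j) i
    where
    regroup : ∀ A B x y → B - (x ℤ.+ y) ≡ ((A ℤ.+ B) - y) ℤ.+ ((- A) - x)
    regroup = solve 4 (λ A B x y → B :- (x :+ y) := ((A :+ B) :- y) :+ ((:- A) :- x)) refl
      where open ℤ-Solver.+-*-Solver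
    pascal : ∀ j a c i → negⁿ j (+ (a C suc c)) - + (suc i C suc c)
           ≡ (negⁿ j (+ (suc a C suc c)) - + (i C suc c)) ℤ.+ (negⁿ (suc j) (+ (a C c)) - + (i C c))
    pascal j a c i
      rewrite sym (nCk+nC[k+1]≡[n+1]C[k+1] a c) | sym (nCk+nC[k+1]≡[n+1]C[k+1] i c)
            | pos-+ (a C c) (a C suc c) | pos-+ (i C c) (i C suc c)
            | negⁿ-+ j (+ (a C c)) (+ (a C suc c))
      = regroup (negⁿ j (+ (a C c))) (negⁿ j (+ (a C suc c))) (+ (i C c)) (+ (i C suc c))

  h-top : ∀ i → h K i ≡ negⁿ K (+ 1) - + 1
  h-top i rewrite n∸n≡0 K = refl

  open DifferenceTable h h-step (λ i → trans (h-top i) (sym (h-top 0))) public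

prime>1 : ∀ {p} → Prime p → 1 < p
prime>1 {p} pr = nonTrivial⇒n>1 p {{prime⇒nonTrivial pr}}

prime∤1 : ∀ {p} → Prime p → ¬ p ∣ 1
prime∤1 pr p∣1 = <⇒≢ (prime>1 pr) (sym (∣1⇒≡1 p∣1))

coprime-*ˡ : ∀ {a b n} → Coprime a n → Coprime b n → Coprime (a * b) n
coprime-*ˡ {a} a⊥n b⊥n {d} (d∣ab , d∣n) = b⊥n (coprime-divisor d⊥a d∣ab , d∣n)
  where
  d⊥a : Coprime d a
  d⊥a (e∣d , e∣a) = a⊥n (e∣a , ∣-trans e∣d d∣n)

coprime⇒*∣ : ∀ {a b n} → Coprime a b → a ∣ n → b ∣ n → a * b ∣ n
coprime⇒*∣ {a} {b} a⊥b (divides q refl) b∣qa = subst (a * b ∣_) (*-comm a q) (*-monoʳ-∣ a b∣q)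
  where
  b∣q : b ∣ q
  b∣q = coprime-divisor (λ (e∣b , e∣a) → a⊥b (e∣a , e∣b)) (subst (b ∣_) (*-comm q a) b∣qa)

prime∤⇒coprime : ∀ {p n} → Prime p → ¬ p ∣ n → Coprime p n
prime∤⇒coprime pr p∤n (d∣p , d∣n) with prime⇒irreducible pr d∣p
... | inj₁ d≡1 = d≡1
... | inj₂ refl = contradiction d∣n p∤n

prime∤⇒coprime-^ : ∀ {p n} → Prime p → ¬ p ∣ n → ∀ a → Coprime (p ^ a) n
prime∤⇒coprime-^ pr p∤n zero    (d∣1 , _) = ∣1⇒≡1 d∣1
prime∤⇒coprime-^ pr p∤n (suc a) = coprime-*ˡ (prime∤⇒coprime pr p∤n) (prime∤⇒coprime-^ pr p∤n a)

prime∣^⇒≡ : ∀ {p q} → Prime p → Prime q → ∀ e → p ∣ q ^ e → p ≡ q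
prime∣^⇒≡ pp pq zero    p∣1 = contradiction p∣1 (prime∤1 pp)
prime∣^⇒≡ {q = q} pp pq (suc e) p∣qqᵉ with euclidsLemma q (q ^ e) pp p∣qqᵉ
... | inj₂ p∣qᵉ = prime∣^⇒≡ pp pq e p∣qᵉ
... | inj₁ p∣q with prime⇒irreducible pq p∣q
...   | inj₂ p≡q = p≡q
...   | inj₁ refl = contradiction ∣-refl (prime∤1 pp)

^-monoʳ-∣ : ∀ m {a b} → a ≤ b → m ^ a ∣ m ^ b
^-monoʳ-∣ m {a} {b} a≤b = subst (m ^ a ∣_) (trans (sym (^-distribˡ-+-* m a (b ∸ a))) (cong (m ^_) (m+[n∸m]≡n a≤b))) (m∣m*n _)

factorOut : ∀ {p} → Prime p → ∀ n → n ≢ 0 → Σ[ a ∈ ℕ ] Σ[ n′ ∈ ℕ ] n ≡ p ^ a * n′ × ¬ p ∣ n′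
factorOut {p} pr = <-rec _ step
  where
  step : ∀ n → (∀ {m} → m < n → m ≢ 0 → Σ[ a ∈ ℕ ] Σ[ m′ ∈ ℕ ] m ≡ p ^ a * m′ × ¬ p ∣ m′) →
         n ≢ 0 → Σ[ a ∈ ℕ ] Σ[ n′ ∈ ℕ ] n ≡ p ^ a * n′ × ¬ p ∣ n′
  step n rec n≢0 with p ∣? n
  ... | no p∤n = 0 , n , sym (+-identityʳ n) , p∤n
  ... | yes (divides q refl) with rec q<qp q≢0
    where
    q≢0 : q ≢ 0
    q≢0 refl = n≢0 refl
    q<qp : q < q * p
    q<qp = m<m*n q p {{≢-nonZero q≢0}} (prime>1 pr)
  ...   | a , n′ , refl , p∤n′ = suc a , n′ , reassoc , p∤n′
    where
    reassoc : p ^ a * n′ * p ≡ p * p ^ a * n′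
    reassoc = trans (*-comm (p ^ a * n′) p) (sym (*-assoc p (p ^ a) n′))

∣-byPrimePowers : ∀ {t N} → t ≢ 0 → (∀ p a → Prime p → p ^ a ∣ t → p ^ a ∣ N) → t ∣ N
∣-byPrimePowers {t} {N} = <-rec (λ t → t ≢ 0 → (∀ p a → Prime p → p ^ a ∣ t → p ^ a ∣ N) → t ∣ N) step t
  where
  step : ∀ t → (∀ {s} → s < t → s ≢ 0 → (∀ p a → Prime p → p ^ a ∣ s → p ^ a ∣ N) → s ∣ N) →
         t ≢ 0 → (∀ p a → Prime p → p ^ a ∣ t → p ^ a ∣ N) → t ∣ N
  step t rec t≢0 hyp with factorise t {{≢-nonZero t≢0}}
  ... | record { factors = [] ; isFactorisation = t≡1 } = subst (_∣ N) (sym t≡1) (1∣ N)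
  ... | record { factors = p ∷ ps ; isFactorisation = eq ; factorsPrime = pr ∷ _ }
    with factorOut pr t t≢0
  ...   | a , t′ , t≡pᵃt′ , p∤t′ =
          subst (_∣ N) (sym t≡pᵃt′) (coprime⇒*∣ (prime∤⇒coprime-^ pr p∤t′ a) (hyp p a pr pᵃ∣t) t′∣N)
    where
    pᵃ∣t : p ^ a ∣ t
    pᵃ∣t = subst (p ^ a ∣_) (sym t≡pᵃt′) (m∣m*n t′)
    t′∣t : t′ ∣ t
    t′∣t = subst (t′ ∣_) (sym t≡pᵃt′) (n∣m*n (p ^ a))
    t′≢0 : t′ ≢ 0
    t′≢0 refl = t≢0 (trans t≡pᵃt′ (*-zeroʳ (p ^ a)))
    p∣t : p ∣ t
    p∣t = subst (p ∣_) (sym eq) (m∣m*n (product ps))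
    t′<t : t′ < t
    t′<t = ≤∧≢⇒< (∣⇒≤ {{≢-nonZero t≢0}} t′∣t) (λ t′≡t → p∤t′ (subst (p ∣_) (sym t′≡t) p∣t))
    t′∣N : t′ ∣ N
    t′∣N = rec t′<t t′≢0 (λ q b pq qᵇ∣t′ → hyp q b pq (∣-trans qᵇ∣t′ t′∣t))

module BinomialColumn (N : ℕ) where

  M : ℕ
  M = suc N

  T : ℕ → ℕ
  T c = (M + c) C suc c

  T-zero : T 0 ≡ M
  T-zero = trans (nC1≡n (M + 0)) (+-identityʳ M)

  M∣T*[c+1] : ∀ c → M ∣ T c * suc c
  M∣T*[c+1] c = subst (M ∣_) (trans (sym ([k+1]*[m+k]C[k+1]≡m*[m+k]Ck M c)) (*-comm (suc c) (T c))) (m∣m*n _)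

  prime∣T : ∀ {p c} → Prime p → ∀ a → p ^ a ∣ M → suc c < p ^ a → p ∣ T c
  prime∣T {p} {c} pr a pᵃ∣M c<pᵃ with p ∣? T c
  ... | yes p∣T = p∣T
  ... | no  p∤T = contradiction (∣⇒≤ pᵃ∣[c+1]) (<⇒≱ c<pᵃ)
    where
    pᵃ∣[c+1] : p ^ a ∣ suc c
    pᵃ∣[c+1] = coprime-divisor (prime∤⇒coprime-^ pr p∤T a) (∣-trans pᵃ∣M (M∣T*[c+1] c))

  prime∤[M+i]Ci : ∀ {p} → Prime p → ∀ a → p ^ a ∣ M → ∀ i → i < p ^ a → ¬ p ∣ (M + i) C i
  prime∤[M+i]Ci pr a pᵃ∣M zero    _     p∣1 = prime∤1 pr p∣1
  prime∤[M+i]Ci {p} pr a pᵃ∣M (suc i) i<pᵃ p∣C =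
    prime∤[M+i]Ci pr a pᵃ∣M i (<-trans (n<1+n i) i<pᵃ) (∣m+n∣m⇒∣n p∣sum (prime∣T pr a pᵃ∣M i<pᵃ))
    where
    p∣sum : p ∣ T i + (M + i) C i
    p∣sum = subst (p ∣_) (trans (cong (_C suc i) (+-suc M i))
              (trans (sym (nCk+nC[k+1]≡[n+1]C[k+1] (M + i) i)) (+-comm _ (T i)))) p∣C

  ∣T⇒∣M : ∀ {g K} → (∀ c → c < K → g ∣ T c) → 0 < K → g ∣ M
  ∣T⇒∣M g∣T 0<K = subst (_ ∣_) T-zero (g∣T 0 0<K)

  -- Writing M = w·q with q = p^a = i + 1, absorption gives T i = w·C(M+i, i) with the
  -- second factor prime to q; so g ∣ gcd(w q, w C(M+i,i)) = w.
  ∣T⇒*prime^∣M : ∀ {g K p} → (∀ c → c < K → g ∣ T c) → Prime p → ∀ a → p ^ a ∣ M → p ^ a ≤ K → g * p ^ a ∣ M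
  ∣T⇒*prime^∣M {g} {K} {p} g∣T pr a q∣M q≤K with p ^ a in q≡pᵃ
  ... | zero  = contradiction (subst (0 <_) q≡pᵃ (m^n>0 p {{prime⇒nonZero pr}} a)) (λ ())
  ... | suc i = subst (g * suc i ∣_) (sym M≡wq) (*-monoˡ-∣ (suc i) g∣w)
    where
    w u : ℕ
    w = quotient q∣M
    u = (M + i) C i
    M≡wq : M ≡ w * suc i
    M≡wq = m∣n⇒n≡quotient*m q∣M
    q⊥u : Coprime (suc i) u
    q⊥u = subst (λ q → Coprime q u) q≡pᵃ (prime∤⇒coprime-^ pr (prime∤[M+i]Ci pr a (subst (_∣ M) (sym q≡pᵃ) q∣M) i (subst (i <_) (sym q≡pᵃ) ≤-refl)) a)
    T≡wu : T i ≡ w * u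
    T≡wu = *-cancelˡ-≡ _ _ (suc i) (begin
      suc i * T i   ≡⟨ [k+1]*[m+k]C[k+1]≡m*[m+k]Ck M i ⟩
      M * u         ≡⟨ cong (_* u) M≡wq ⟩
      w * suc i * u ≡⟨ cong (_* u) (*-comm w (suc i)) ⟩
      suc i * w * u ≡⟨ *-assoc (suc i) w u ⟩
      suc i * (w * u) ∎)
      where open ≡-Reasoning
    g∣w : g ∣ w
    g∣w = subst (g ∣_) (trans (sym (c*gcd[m,n]≡gcd[cm,cn] w (suc i) u)) (trans (cong (w *_) (coprime⇒gcd≡1 q⊥u)) (*-identityʳ w)))
            (gcd-greatest (subst (g ∣_) M≡wq (∣T⇒∣M g∣T (<-≤-trans z<s q≤K))) (subst (g ∣_) T≡wu (g∣T i q≤K)))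

  ∣M⇒≢0 : ∀ {x} → x ∣ M → x ≢ 0
  ∣M⇒≢0 x∣M refl with 0∣⇒≡0 x∣M
  ... | ()

  ∣T⇒*∣M : ∀ {g K t} → (∀ c → c < K → g ∣ T c) → 0 < K → t ∣ M →
           (∀ p a → Prime p → p ^ a ∣ t → p ^ a ≤ K) → g * t ∣ M
  ∣T⇒*∣M {g} {K} {t} g∣T 0<K t∣M small = m∣n/o⇒o*m∣n g∣M t∣M/g
    where
    g∣M : g ∣ M
    g∣M = ∣T⇒∣M g∣T 0<K
    instance
      g-nonZero : NonZero g
      g-nonZero = ≢-nonZero (∣M⇒≢0 g∣M)
    t∣M/g : t ∣ M / g
    t∣M/g = ∣-byPrimePowers (∣M⇒≢0 t∣M) λ p a pr pᵃ∣t →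
      m*n∣o⇒n∣o/m g (p ^ a) (∣T⇒*prime^∣M g∣T pr a (∣-trans pᵃ∣t t∣M) (small p a pr pᵃ∣t))

  ∣T⇒≡1 : ∀ {g K} → (∀ c → c < K → g ∣ T c) → 0 < K → M ≤ K → g ≡ 1
  ∣T⇒≡1 {g} g∣T 0<K M≤K = ∣1⇒≡1 (*-cancelʳ-∣ M (subst (g * M ∣_) (sym (*-identityˡ M)) gM∣M))
    where
    gM∣M : g * M ∣ M
    gM∣M = ∣T⇒*∣M g∣T 0<K ∣-refl (λ p a _ pᵃ∣M → ≤-trans (∣⇒≤ pᵃ∣M) M≤K)

  prime^∣M : ∀ {p K} → Prime p → (∀ c → c < K → p ∣ T c) → ∀ a → p ^ a ≤ K → p ^ suc a ∣ M
  prime^∣M pr p∣T zero    1≤K   = subst (_∣ M) (sym (*-identityʳ _)) (∣T⇒∣M p∣T 1≤K)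
  prime^∣M {p} pr p∣T (suc a) pᵃ⁺¹≤K =
    ∣T⇒*prime^∣M p∣T pr (suc a) (prime^∣M pr p∣T a (≤-trans (^-monoʳ-≤ p {{prime⇒nonZero pr}} (n≤1+n a)) pᵃ⁺¹≤K)) pᵃ⁺¹≤K

  module _ {P : ℕ} where
    instance
      gcd-nonZero : NonZero (gcd M P)
      gcd-nonZero = ≢-nonZero (gcd[m,n]≢0 M P (inj₁ (λ ())))

    /gcd∣T : ∀ {K} → (∀ t → 0 < t → t ≤ K → t ∣ P) → ∀ c → c < K → N /gcd P ∣ T c
    /gcd∣T ∣P c c<K = m∣n*o⇒m/n∣o (gcd[m,n]∣m M P) (∣-trans M∣T*gcd[c+1,M] (*-monoʳ-∣ (T c) gcd[c+1,M]∣gcd[M,P]))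
      where
      M∣T*gcd[c+1,M] : M ∣ T c * gcd (suc c) M
      M∣T*gcd[c+1,M] = subst (M ∣_) (sym (c*gcd[m,n]≡gcd[cm,cn] (T c) (suc c) M)) (gcd-greatest (M∣T*[c+1] c) (n∣m*n (T c)))
      gcd[c+1,M]∣gcd[M,P] : gcd (suc c) M ∣ gcd M P
      gcd[c+1,M]∣gcd[M,P] = gcd-greatest (gcd[m,n]∣n (suc c) M) (∣P _ (gcd>0) (≤-trans (∣⇒≤ (gcd[m,n]∣m (suc c) M)) c<K))
        where
        gcd>0 : 0 < gcd (suc c) M
        gcd>0 = n≢0⇒n>0 (gcd[m,n]≢0 (suc c) M (inj₁ (λ ())))

    ∣T⇒∣/gcd : ∀ {g K} → (∀ p a → Prime p → p ^ a ∣ P → p ^ a ≤ K) → (∀ c → c < K → g ∣ T c) → 0 < K → g ∣ N /gcd P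
    ∣T⇒∣/gcd small g∣T 0<K = m*n∣o⇒m∣o/n _ (gcd M P)
      (∣T⇒*∣M g∣T 0<K (gcd[m,n]∣m M P) (λ p a pr pᵃ∣gcd → small p a pr (∣-trans pᵃ∣gcd (gcd[m,n]∣n M P))))

oneTo-suc : ∀ n → oneTo (suc n) ≡ oneTo n ++ [ suc n ]
oneTo-suc n = trans (cong (map suc) (sym (upTo-∷ʳ n))) (map-++ suc (upTo n) [ n ])

module PrimePowerProduct (ex : ℕ → ℕ) where

  L : ℕ → ℕ
  L n = product (map (λ p → p ^ ex p) (primesUpTo n))

  L-suc : ∀ n → L (suc n) ≡ L n * product (map (λ p → p ^ ex p) (filter prime? [ suc n ]))
  L-suc n = begin
    L (suc n)                                                       ≡⟨ cong (λ xs → product (map f (filter prime? xs))) (oneTo-suc n) ⟩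
    product (map f (filter prime? (oneTo n ++ [ suc n ])))           ≡⟨ cong (λ xs → product (map f xs)) (filter-++ prime? (oneTo n) [ suc n ]) ⟩
    product (map f (primesUpTo n ++ filter prime? [ suc n ]))        ≡⟨ cong product (map-++ f (primesUpTo n) _) ⟩
    product (map f (primesUpTo n) ++ map f (filter prime? [ suc n ])) ≡⟨ product-++ (map f (primesUpTo n)) _ ⟩
    L n * product (map f (filter prime? [ suc n ]))                   ∎
    where
    open ≡-Reasoning
    f : ℕ → ℕ
    f p = p ^ ex p

  L-suc-prime : ∀ {n} → Prime (suc n) → L (suc n) ≡ L n * suc n ^ ex (suc n)
  L-suc-prime {n} pr with prime? (suc n) | L-suc n
  ... | yes _ | eq = trans eq (cong (L n *_) (*-identityʳ _))
  ... | no ¬pr | _ = contradiction pr ¬pr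

  L-suc-¬prime : ∀ {n} → ¬ Prime (suc n) → L (suc n) ≡ L n
  L-suc-¬prime {n} ¬pr with prime? (suc n) | L-suc n
  ... | yes pr | _ = contradiction pr ¬pr
  ... | no _ | eq = trans eq (*-identityʳ (L n))

  prime∣L⇒≤ : ∀ {p} n → Prime p → p ∣ L n → p ≤ n
  prime∣L⇒≤ zero pr p∣1 = contradiction p∣1 (prime∤1 pr)
  prime∣L⇒≤ (suc n) pr p∣L with prime? (suc n)
  ... | no ¬q = m≤n⇒m≤1+n (prime∣L⇒≤ n pr (subst (_ ∣_) (L-suc-¬prime ¬q) p∣L))
  ... | yes q with euclidsLemma (L n) _ pr (subst (_ ∣_) (L-suc-prime q) p∣L)
  ...   | inj₁ p∣L′ = m≤n⇒m≤1+n (prime∣L⇒≤ n pr p∣L′)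
  ...   | inj₂ p∣qᵉ = ≤-reflexive (prime∣^⇒≡ pr q (ex (suc n)) p∣qᵉ)

  L∣L-suc : ∀ n → L n ∣ L (suc n)
  L∣L-suc n = subst (L n ∣_) (sym (L-suc n)) (m∣m*n _)

  ^ex∣L : ∀ {p} n → Prime p → p ≤ n → p ^ ex p ∣ L n
  ^ex∣L zero pr p≤0 = contradiction (≤-trans (prime>1 pr) p≤0) (λ ())
  ^ex∣L {p} (suc n) pr p≤1+n with m≤n⇒m<n∨m≡n p≤1+n
  ... | inj₁ p<1+n = ∣-trans (^ex∣L n pr (≤-pred p<1+n)) (L∣L-suc n)
  ... | inj₂ refl  = subst (p ^ ex p ∣_) (sym (L-suc-prime pr)) (n∣m*n (L n))

  prime^∣L⇒∣^ex : ∀ {p} n → Prime p → ∀ a → p ^ a ∣ L n → p ^ a ∣ p ^ ex p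
  prime^∣L⇒∣^ex zero pr a pᵃ∣1 = subst (_∣ _) (sym (∣1⇒≡1 pᵃ∣1)) (1∣ _)
  prime^∣L⇒∣^ex {p} (suc n) pr a pᵃ∣L with prime? (suc n)
  ... | no ¬q = prime^∣L⇒∣^ex n pr a (subst (p ^ a ∣_) (L-suc-¬prime ¬q) pᵃ∣L)
  ... | yes q with p ≟ suc n
  ...   | yes refl = coprime-divisor (prime∤⇒coprime-^ pr p∤L a) (subst (p ^ a ∣_) (L-suc-prime q) pᵃ∣L)
    where
    p∤L : ¬ p ∣ L n
    p∤L p∣L = <⇒≱ (n<1+n n) (prime∣L⇒≤ n pr p∣L)
  ...   | no p≢q = prime^∣L⇒∣^ex n pr a (coprime-divisor (prime∤⇒coprime-^ pr p∤qᵉ a)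
                     (subst (p ^ a ∣_) (trans (L-suc-prime q) (*-comm (L n) _)) pᵃ∣L))
    where
    p∤qᵉ : ¬ p ∣ suc n ^ ex (suc n)
    p∤qᵉ p∣qᵉ = p≢q (prime∣^⇒≡ pr q (ex (suc n)) p∣qᵉ)

  module _ {K : ℕ} (ex-spec : ∀ p → Prime p → p ≤ K → p ^ ex p ≤ K × K < p ^ (ex p + 1)) where

    ∣L : ∀ t → 0 < t → t ≤ K → t ∣ L K
    ∣L t 0<t t≤K = ∣-byPrimePowers (≢-nonZero⁻¹ t {{>-nonZero 0<t}}) pᵃ∣L
      where
      pᵃ∣L : ∀ p a → Prime p → p ^ a ∣ t → p ^ a ∣ L K
      pᵃ∣L p zero    _  _     = 1∣ L K
      pᵃ∣L p (suc a) pr pᵃ∣t = ∣-trans (^-monoʳ-∣ p a≤ex) (^ex∣L K pr p≤K)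
        where
        instance
          p-nonZero : NonZero p
          p-nonZero = prime⇒nonZero pr
        pᵃ≤K : p ^ suc a ≤ K
        pᵃ≤K = ≤-trans (∣⇒≤ {{>-nonZero 0<t}} pᵃ∣t) t≤K
        p≤K : p ≤ K
        p≤K = ≤-trans (subst (_≤ p ^ suc a) (*-identityʳ p) (*-monoʳ-≤ p (m^n>0 p a))) pᵃ≤K
        a≤ex : suc a ≤ ex p
        a≤ex with suc a ≤? ex p
        ... | yes a≤ex = a≤ex
        ... | no  a≰ex = contradiction (≤-trans (^-monoʳ-≤ p (subst (_≤ suc a) (+-comm 1 (ex p)) (≰⇒> a≰ex))) pᵃ≤K)
                           (<⇒≱ (proj₂ (ex-spec p pr p≤K)))

    prime^∣L⇒≤ : 0 < K → ∀ p a → Prime p → p ^ a ∣ L K → p ^ a ≤ K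
    prime^∣L⇒≤ 0<K p zero    _  _     = 0<K
    prime^∣L⇒≤ 0<K p (suc a) pr pᵃ∣L = ≤-trans (∣⇒≤ {{m^n≢0 p (ex p)}} (prime^∣L⇒∣^ex K pr (suc a) pᵃ∣L)) (proj₁ (ex-spec p pr p≤K))
      where
      instance
        p-nonZero : NonZero p
        p-nonZero = prime⇒nonZero pr
      p≤K : p ≤ K
      p≤K = prime∣L⇒≤ K pr (∣-trans (m∣m*n (p ^ a)) pᵃ∣L)

gcdList∣ : ∀ {x xs} → x ∈ xs → gcdList xs ∣ x
gcdList∣ {xs = y ∷ ys} (here refl) = gcd[m,n]∣m y _
gcdList∣ {xs = y ∷ ys} (there x∈ys) = ∣-trans (gcd[m,n]∣n y _) (gcdList∣ x∈ys)

gcdList-greatest : ∀ {x xs} → All (x ∣_) xs → x ∣ gcdList xs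
gcdList-greatest {x} All.[] = x ∣0
gcdList-greatest (x∣y ∷ x∣ys) = gcd-greatest x∣y (gcdList-greatest x∣ys)

G∣m : ∀ {d k i} → 0 < i → i ≤ d / 2 → G d k ∣ m d i k
G∣m {i = suc i} _ i<δ = gcdList∣ (∈-map⁺ _ (∈-map⁺ suc (∈-upTo⁺ i<δ)))

∣m⇒∣G : ∀ {d k x} → (∀ i → 0 < i → i ≤ d / 2 → x ∣ m d i k) → x ∣ G d k
∣m⇒∣G {d} x∣m = gcdList-greatest (All.map⁺ (All.map⁺ (All.map (λ {i} i<δ → x∣m (suc i) z<s i<δ) (All.all-upTo (d / 2)))))

module Reduction (d k : ℕ) where

  n K δ : ℕ
  n = d + 1
  K = k + 1
  δ = d / 2

  open BinomialTable n K public
  open BinomialColumn (d ∸ k) public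

  δ+δ<n : δ + δ < n
  δ+δ<n = subst (_< n) (trans (*-comm δ 2) (cong (λ x → δ + x) (+-identityʳ δ))) (≤-<-trans (m/n*n≤m d 2) d<n)
    where
    d<n : d < n
    d<n = subst (d <_) (+-comm 1 d) (n<1+n d)

  n≤[1+δ]+[1+δ] : n ≤ suc δ + suc δ
  n≤[1+δ]+[1+δ] = begin
    d + 1               ≡⟨ +-comm d 1 ⟩
    suc d               ≡⟨ cong suc (m≡m%n+[m/n]*n d 2) ⟩
    suc (d % 2 + δ * 2) ≤⟨ s≤s (+-monoˡ-≤ (δ * 2) (≤-pred (m%n<n d 2))) ⟩
    suc (1 + δ * 2)     ≡⟨ solve 1 (λ δ → con 2 :+ δ :* con 2 := (con 1 :+ δ) :+ (con 1 :+ δ)) refl δ ⟩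
    suc δ + suc δ       ∎
    where
    open ≤-Reasoning
    open +-*-Solver

  ≤δ∨n∸≤δ∨n∸≡ : ∀ i → i ≤ n → i ≤ δ ⊎ n ∸ i ≤ δ ⊎ n ∸ i ≡ i
  ≤δ∨n∸≤δ∨n∸≡ i i≤n with i ≤? δ | n ∸ i ≤? δ
  ... | yes i≤δ | _        = inj₁ i≤δ
  ... | no _    | yes i′≤δ = inj₂ (inj₁ i′≤δ)
  ... | no i≰δ  | no i′≰δ  = inj₂ (inj₂ (trans (≤-antisym i′≤1+δ (≰⇒> i′≰δ)) (≤-antisym (≰⇒> i≰δ) i≤1+δ)))
    where
    i+i′≤ : i + (n ∸ i) ≤ suc δ + suc δ
    i+i′≤ = subst (_≤ suc δ + suc δ) (sym (m+[n∸m]≡n i≤n)) n≤[1+δ]+[1+δ]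
    i≤1+δ : i ≤ suc δ
    i≤1+δ = +-cancelʳ-≤ (n ∸ i) i (suc δ) (≤-trans i+i′≤ (+-monoʳ-≤ (suc δ) (≰⇒> i′≰δ)))
    i′≤1+δ : n ∸ i ≤ suc δ
    i′≤1+δ = +-cancelˡ-≤ i (n ∸ i) (suc δ) (≤-trans i+i′≤ (+-monoˡ-≤ (suc δ) (≰⇒> i≰δ)))

  m≡h₀ : ∀ {i} → i ≤ δ → + m d i k ≡ h 0 i
  m≡h₀ {i} i≤δ = trans (sym (⊖-≥ (C-monoˡ-≤ K i≤n∸i))) (sym ([+m]-[+n]≡m⊖n ((n ∸ i) C K) (i C K)))
    where
    i≤n∸i : i ≤ n ∸ i
    i≤n∸i = subst (_≤ n ∸ i) (m+n∸n≡m i i) (∸-monoˡ-≤ i (<⇒≤ (≤-<-trans (+-mono-≤ i≤δ i≤δ) δ+δ<n)))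

  h₀-antisym : ∀ {i} → i ≤ n → h 0 (n ∸ i) ≡ - h 0 i
  h₀-antisym {i} i≤n rewrite m∸[m∸n]≡n i≤n = begin
    + (i C K) - + ((n ∸ i) C K)     ≡⟨ [+m]-[+n]≡m⊖n (i C K) ((n ∸ i) C K) ⟩
    (i C K) ⊖ ((n ∸ i) C K)         ≡⟨ ⊖-swap (i C K) ((n ∸ i) C K) ⟩
    - ((n ∸ i) C K ⊖ (i C K))       ≡⟨ cong -_ ([+m]-[+n]≡m⊖n ((n ∸ i) C K) (i C K)) ⟨
    - (+ ((n ∸ i) C K) - + (i C K)) ∎
    where open ≡-Reasoning

  h₀-middle : ∀ {i} → n ∸ i ≡ i → h 0 i ≡ + 0
  h₀-middle n∸i≡i = i≡j⇒i-j≡0 (cong (λ a → + (a C K)) n∸i≡i)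

  n∸j≡M+[K∸[1+j]] : K ≤ d → ∀ {j} → j < K → n ∸ j ≡ M + (K ∸ suc j)
  n∸j≡M+[K∸[1+j]] K≤d {j} j<K = begin
    d + 1 ∸ j          ≡⟨ cong (_∸ j) (+-comm d 1) ⟩
    suc d ∸ j          ≡⟨ cong (λ x → suc x ∸ j) (sym (m∸n+n≡m k≤d)) ⟩
    M + k ∸ j          ≡⟨ +-∸-assoc M j≤k ⟩
    M + (k ∸ j)        ≡⟨ cong (λ x → M + (x ∸ suc j)) (+-comm 1 k) ⟩
    M + (K ∸ suc j)    ∎
    where
    open ≡-Reasoning
    k≤d : k ≤ d
    k≤d = ≤-trans (m≤m+n k 1) K≤d
    j≤k : j ≤ k
    j≤k = ≤-pred (subst (j <_) (+-comm k 1) j<K)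

  h-column₀ : K ≤ d → ∀ j → j < K → h j 0 ≡ negⁿ j (+ T (K ∸ suc j))
  h-column₀ K≤d j j<K rewrite ∸-suc j<K | n∸j≡M+[K∸[1+j]] K≤d j<K = ℤ.+-identityʳ _

  0<K : 0 < K
  0<K = subst (0 <_) (+-comm 1 k) z<s

  K∸[1+j]<K : ∀ j → K ∸ suc j < K
  K∸[1+j]<K j = subst (λ K → K ∸ suc j < K) (+-comm 1 k) (s≤s (m∸n≤m k j))

  ∣m⇒∣row₀ : ∀ {g} → (∀ i → 0 < i → i ≤ δ → g ∣ m d i k) → ∀ i → 0 < i → i < n → + g ∣ᶻ h 0 i
  ∣m⇒∣row₀ {g} g∣m i 0<i i<n with ≤δ∨n∸≤δ∨n∸≡ i (<⇒≤ i<n)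
  ... | inj₁ i≤δ = subst (+ g ∣ᶻ_) (m≡h₀ i≤δ) (ℤ.∣ᵤ⇒∣ (g∣m i 0<i i≤δ))
  ... | inj₂ (inj₁ n∸i≤δ) = subst (+ g ∣ᶻ_) -h₀[n∸i]≡h₀i (ℤ.∣m⇒∣-m (subst (+ g ∣ᶻ_) (m≡h₀ n∸i≤δ)
                               (ℤ.∣ᵤ⇒∣ (g∣m (n ∸ i) (m<n⇒0<n∸m i<n) n∸i≤δ))))
    where
    -h₀[n∸i]≡h₀i : - h 0 (n ∸ i) ≡ h 0 i
    -h₀[n∸i]≡h₀i = trans (cong -_ (h₀-antisym (<⇒≤ i<n))) (neg-involutive (h 0 i))
  ... | inj₂ (inj₂ n∸i≡i) = subst (+ g ∣ᶻ_) (sym (h₀-middle n∸i≡i)) (ℤ.∣ᵤ⇒∣ (g ∣0))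

  ∣row₀⇒∣m : ∀ {x} → (∀ i → i < n → + x ∣ᶻ h 0 i) → ∀ i → 0 < i → i ≤ δ → x ∣ m d i k
  ∣row₀⇒∣m {x} x∣row i _ i≤δ =
    ℤ.∣⇒∣ᵤ (subst (+ x ∣ᶻ_) (sym (m≡h₀ i≤δ)) (x∣row i (≤-<-trans (≤-trans i≤δ (m≤m+n δ δ)) δ+δ<n)))

  G∣column₀ : K < d → ∀ j → j ≤ K → + G d k ∣ᶻ h j 0
  G∣column₀ K<d = ∣row₀⇒∣column₀ (subst (suc K <_) (+-comm 1 d) (s≤s K<d)) (∣m⇒∣row₀ (λ i → G∣m {d} {k}))

  G∣T : K < d → ∀ c → c < K → G d k ∣ T c
  G∣T K<d c c<K = ℤ.∣⇒∣ᵤ (∣negⁿ⁻¹ j (subst (+ G d k ∣ᶻ_) h-column₀[j] (G∣column₀ K<d j (<⇒≤ (K∸[1+j]<K c)))))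
    where
    j : ℕ
    j = K ∸ suc c
    h-column₀[j] : h j 0 ≡ negⁿ j (+ T c)
    h-column₀[j] = trans (h-column₀ (<⇒≤ K<d) j (K∸[1+j]<K c))
                     (cong (λ c → negⁿ j (+ T c)) (trans (cong (K ∸_) (sym (∸-suc c<K))) (m∸[m∸n]≡n (<⇒≤ c<K))))

  G∣h-top : K < d → + G d k ∣ᶻ negⁿ K (+ 1) - + 1
  G∣h-top K<d = subst (+ G d k ∣ᶻ_) (h-top 0) (G∣column₀ K<d K ≤-refl)

  ∣T⇒∣G : ∀ {x} → K ≤ d → (∀ c → c < K → x ∣ T c) → + x ∣ᶻ negⁿ K (+ 1) - + 1 → x ∣ G d k
  ∣T⇒∣G {x} K≤d x∣T x∣top = ∣m⇒∣G {d} {k} (∣row₀⇒∣m (∣column₀⇒∣row₀ x∣column₀))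
    where
    x∣column₀ : ∀ j → j ≤ K → + x ∣ᶻ h j 0
    x∣column₀ j j≤K with m≤n⇒m<n∨m≡n j≤K
    ... | inj₁ j<K  = subst (+ x ∣ᶻ_) (sym (h-column₀ K≤d j j<K)) (∣negⁿ j (ℤ.∣ᵤ⇒∣ (x∣T (K ∸ suc j) (K∸[1+j]<K j))))
    ... | inj₂ refl = subst (+ x ∣ᶻ_) (sym (h-top 0)) x∣top

k+1≤d : ∀ {d k} → 2 ≤ d → k ≤ d ∸ 1 → k + 1 ≤ d
k+1≤d {d} {k} 2≤d k≤d∸1 = subst (k + 1 ≤_) (m∸n+n≡m (≤-trans (s≤s z≤n) 2≤d)) (+-monoˡ-≤ 1 k≤d∸1)

k<[d+1]/2⇒k+1<d : ∀ {d k} → 2 ≤ d → k < (d + 1) / 2 → k + 1 < d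
k<[d+1]/2⇒k+1<d {k = zero}  2≤d _   = 2≤d
k<[d+1]/2⇒k+1<d {d} {suc k} _   k<q = +-cancelʳ-≤ 1 (suc (suc k + 1)) d (≤-trans k+4≤[k+2]*2 [k+2]*2≤d+1)
  where
  open +-*-Solver
  [k+2]*2≤d+1 : (suc k + 1) * 2 ≤ d + 1
  [k+2]*2≤d+1 = ≤-trans (*-monoˡ-≤ 2 (subst (_≤ (d + 1) / 2) (+-comm 1 (suc k)) k<q)) (m/n*n≤m (d + 1) 2)
  k+4≤[k+2]*2 : suc (suc k + 1) + 1 ≤ (suc k + 1) * 2
  k+4≤[k+2]*2 = begin
    suc (suc k + 1) + 1 ≡⟨ solve 1 (λ k → (con 1 :+ (con 1 :+ k :+ con 1)) :+ con 1 := con 4 :+ k) refl k ⟩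
    4 + k               ≤⟨ m≤m+n (4 + k) k ⟩
    4 + k + k           ≡⟨ solve 1 (λ k → con 4 :+ k :+ k := (con 1 :+ k :+ con 1) :* con 2) refl k ⟩
    (suc k + 1) * 2     ∎
    where open ≤-Reasoning

[d+1]/2≤k⇒d∸k<k+1 : ∀ {d k} → (d + 1) / 2 ≤ k → suc (d ∸ k) ≤ k + 1
[d+1]/2≤k⇒d∸k<k+1 {d} {k} q≤k = subst (suc (d ∸ k) ≤_) (+-comm 1 k) (s≤s d∸k≤k)
  where
  open +-*-Solver
  d+1≤1+k*2 : d + 1 ≤ 1 + k * 2
  d+1≤1+k*2 = subst (_≤ 1 + k * 2) (sym (m≡m%n+[m/n]*n (d + 1) 2))
                (+-mono-≤ (≤-pred (m%n<n (d + 1) 2)) (*-monoˡ-≤ 2 q≤k))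
  d≤k+k : d ≤ k + k
  d≤k+k = ≤-pred (subst₂ _≤_ (+-comm d 1) (solve 1 (λ k → con 1 :+ k :* con 2 := con 1 :+ (k :+ k)) refl k) d+1≤1+k*2)
  d∸k≤k : d ∸ k ≤ k
  d∸k≤k = subst (d ∸ k ≤_) (m+n∸n≡m k k) (∸-monoˡ-≤ k d≤k+k)

negⁿ[k+1]-1≡-2 : ∀ k → k % 2 ≡ 0 → negⁿ (k + 1) (+ 1) - + 1 ≡ - + 2
negⁿ[k+1]-1≡-2 k k%2≡0 = trans (cong (λ j → negⁿ j (+ 1) - + 1) k+1≡1+[k/2]*2) (cong (λ z → - z - + 1) (negⁿ-even (k / 2) (+ 1)))
  where
  k+1≡1+[k/2]*2 : k + 1 ≡ suc (k / 2 * 2)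
  k+1≡1+[k/2]*2 = trans (+-comm k 1) (cong suc (trans (m≡m%n+[m/n]*n k 2) (cong (_+ k / 2 * 2) k%2≡0)))

negⁿ[k+1]-1≡0 : ∀ k → k % 2 ≡ 1 → negⁿ (k + 1) (+ 1) - + 1 ≡ + 0
negⁿ[k+1]-1≡0 k k%2≡1 = trans (cong (λ j → negⁿ j (+ 1) - + 1) k+1≡[1+k/2]*2) (cong (_- + 1) (negⁿ-even (suc (k / 2)) (+ 1)))
  where
  k+1≡[1+k/2]*2 : k + 1 ≡ suc (k / 2) * 2
  k+1≡[1+k/2]*2 = trans (+-comm k 1) (cong suc (trans (m≡m%n+[m/n]*n k 2) (cong (_+ k / 2 * 2) k%2≡1)))

module Theorem (d k : ℕ) where

  open Reduction d k

  G-large : 2 ≤ d → k ≤ d ∸ 1 → (d + 1) / 2 ≤ k → G d k ≡ 1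
  G-large 2≤d k≤d∸1 q≤k with m≤n⇒m<n∨m≡n (k+1≤d 2≤d k≤d∸1)
  ... | inj₁ K<d = ∣T⇒≡1 (G∣T K<d) 0<K ([d+1]/2≤k⇒d∸k<k+1 q≤k)
  ... | inj₂ K≡d = ∣1⇒≡1 (subst (G d k ∣_) m₁≡1 (G∣m {d} {k} z<s (m≥n⇒m/n>0 2≤d)))
    where
    m₁≡1 : m d 1 k ≡ 1
    m₁≡1 = begin
      (d + 1 ∸ 1) C K ∸ 1 C K ≡⟨ cong (λ x → x C K ∸ 1 C K) (m+n∸n≡m d 1) ⟩
      d C K ∸ 1 C K           ≡⟨ cong (λ K → d C K ∸ 1 C K) K≡d ⟩
      d C d ∸ 1 C d           ≡⟨ cong₂ _∸_ (nCn≡1 d) (k>n⇒nCk≡0 2≤d) ⟩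
      1                       ∎
      where open ≡-Reasoning

  module _ (2≤d : 2 ≤ d) (k<q : k < (d + 1) / 2) where

    private
      K<d : K < d
      K<d = k<[d+1]/2⇒k+1<d 2≤d k<q

    module _ (k%2≡0 : k % 2 ≡ 0) (e : ℕ) (2ᵉ≤K : 2 ^ e ≤ K) (K<2ᵉ⁺¹ : K < 2 ^ (e + 1)) where

      G∣2 : G d k ∣ 2
      G∣2 = ℤ.∣⇒∣ᵤ (subst (+ G d k ∣ᶻ_) (negⁿ[k+1]-1≡-2 k k%2≡0) (G∣h-top K<d))

      G-even-∣ : 2 ^ (e + 1) ∣ (d ∸ k) + 1 → G d k ≡ 2
      G-even-∣ 2ᵉ⁺¹∣M = ∣-antisym G∣2 (∣T⇒∣G (<⇒≤ K<d) 2∣T 2∣top)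
        where
        2∣T : ∀ c → c < K → 2 ∣ T c
        2∣T c c<K = prime∣T prime[2] (e + 1) (subst (2 ^ (e + 1) ∣_) (+-comm (d ∸ k) 1) 2ᵉ⁺¹∣M) (≤-<-trans c<K K<2ᵉ⁺¹)
        2∣top : + 2 ∣ᶻ negⁿ K (+ 1) - + 1
        2∣top = subst (+ 2 ∣ᶻ_) (sym (negⁿ[k+1]-1≡-2 k k%2≡0)) (ℤ.∣m⇒∣-m ℤ.∣-refl)

      G-even-∤ : ¬ 2 ^ (e + 1) ∣ (d ∸ k) + 1 → G d k ≡ 1
      G-even-∤ 2ᵉ⁺¹∤M with prime⇒irreducible prime[2] G∣2
      ... | inj₁ G≡1 = G≡1
      ... | inj₂ G≡2 = contradiction (subst₂ _∣_ (cong (2 ^_) (+-comm 1 e)) (+-comm 1 (d ∸ k)) (prime^∣M prime[2] 2∣T e 2ᵉ≤K)) 2ᵉ⁺¹∤M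
        where
        2∣T : ∀ c → c < K → 2 ∣ T c
        2∣T c c<K = subst (_∣ T c) G≡2 (G∣T K<d c c<K)

    G-odd : k % 2 ≡ 1 → (ex : ℕ → ℕ) →
            ((p : ℕ) → Prime p → p ≤ K → 1 ≤ ex p × p ^ ex p ≤ K × K < p ^ (ex p + 1)) →
            G d k ≡ (d ∸ k) /gcd product (map (λ p → p ^ ex p) (primesUpTo K))
    G-odd k%2≡1 ex ex-spec = ∣-antisym (∣T⇒∣/gcd (prime^∣L⇒≤ spec 0<K) (G∣T K<d) 0<K) (∣T⇒∣G (<⇒≤ K<d) (/gcd∣T (∣L spec)) ∣top)
      where
      open PrimePowerProduct ex
      spec : ∀ p → Prime p → p ≤ K → p ^ ex p ≤ K × K < p ^ (ex p + 1)
      spec p pr p≤K = proj₂ (ex-spec p pr p≤K)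
      ∣top : + ((d ∸ k) /gcd L K) ∣ᶻ negⁿ K (+ 1) - + 1
      ∣top = subst (+ ((d ∸ k) /gcd L K) ∣ᶻ_) (sym (negⁿ[k+1]-1≡0 k k%2≡1)) (ℤ.∣ᵤ⇒∣ (_ ∣0))

theorem3p1 : (d k : ℕ) → 2 ≤ d → k ≤ d ∸ 1 →
    ((d + 1) / 2 ≤ k → G d k ≡ 1)
    × (k < (d + 1) / 2 → (k % 2 ≡ 0) → (e : ℕ) → 2 ^ e ≤ k + 1 → k + 1 < 2 ^ (e + 1) →
        ((2 ^ (e + 1) ∣ (d ∸ k) + 1 → G d k ≡ 2)
         × (¬ (2 ^ (e + 1) ∣ (d ∸ k) + 1) → G d k ≡ 1)))
    × (k < (d + 1) / 2 → (k % 2 ≡ 1) → (ex : ℕ → ℕ) →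
        ((p : ℕ) → Prime p → p ≤ k + 1 → 1 ≤ ex p × p ^ ex p ≤ k + 1 × k + 1 < p ^ (ex p + 1)) →
        G d k ≡ (d ∸ k) /gcd product (map (λ p → p ^ ex p) (primesUpTo (k + 1))))
theorem3p1 d k 2≤d k≤d∸1 =
  G-large 2≤d k≤d∸1 ,
  (λ k<q k%2≡0 e 2ᵉ≤K K<2ᵉ⁺¹ → G-even-∣ 2≤d k<q k%2≡0 e 2ᵉ≤K K<2ᵉ⁺¹ , G-even-∤ 2≤d k<q k%2≡0 e 2ᵉ≤K K<2ᵉ⁺¹) ,
  G-odd 2≤d
  where open Theorem d k
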